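{- For every finite simplicial complex $X$, $\mathcal{C}(X) \leq \theta(X)$.
   Context: A simplicial complex $X$ on a finite set $V$ is a family of subsets of $V$ closed under taking subsets; its vertices are those $v\in V$ with $\{v\}\in X$. For a vertex $v$ let $\mathrm{del}(X;v)=\{S\in X: v\notin S\}$ and $\mathrm{lk}(X;v)=\{T\in X: v\notin T,\ T\cup\{v\}\in X\}$. A vertex $v$ is a cone vertex if $\mathrm{lk}(X;v)=\mathrm{del}(X;v)$; let $V(X)^\circ$ be the set of vertices of $X$ that are not cone vertices. The theta-number is defined recursively by $\theta(X)=0$ if $V(X)^\circ=\emptyset$, and otherwise $\theta(X)=\min_{v\in V(X)^\circ}\max\{\theta(\mathrm{del}(X;v)),\ \theta(\mathrm{lk}(X;v))+1\}$. A face $A\in X$ is free if it is contained in a unique maximal face (facet) $B$ of $X$; removing the interval $[A,B]=\{C\in X: A\subseteq C\subseteq B\}$ from $X$ is an elementary $k$-collapse if $|A|\leq k$. $X$ is $k$-collapsible if it can be reduced to the void complex $\emptyset$ (the complex with no faces) by a sequence of elementary $k$-collapses. The collapsibility number $\mathcal{C}(X)$ is the least $k$ such that $X$ is $k$-collapsible. -}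

module Defs where

open import Data.Nat using (ℕ; zero; suc; _≤_; _⊓_; _⊔_; _+_)
open import Data.Bool using (Bool; true; false; _∧_; not; if_then_else_)
open import Data.Bool.Properties using () renaming (_≟_ to _≟ᵇ_)
open import Data.Fin using (Fin)
open import Data.Fin.Subset using (Subset; _⊆_; ⁅_⁆; _∪_; ∣_∣; outside; inside)
open import Data.Vec using (Vec; []; _∷_; lookup)
open import Data.List using (List; []; _∷_; map; filter; allFin; _++_)
open import Data.Bool.ListAction using (and)
open import Data.Product using (Σ; _×_; _,_)
open import Relation.Nullary using (¬_)
open import Relation.Nullary.Decidable using (⌊_⌋)
open import Relation.Binary.PropositionalEquality using (_≡_)

Family : ℕ → Set
Family n = Subset n → Bool

record Complex (n : ℕ) : Set where
  field
    face     : Family n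
    downward : ∀ S T → T ⊆ S → face S ≡ true → face T ≡ true
open Complex public

allSubsets : (n : ℕ) → List (Subset n)
allSubsets zero    = [] ∷ []
allSubsets (suc n) = map (outside ∷_) (allSubsets n) ++ map (inside ∷_) (allSubsets n)

del : ∀ {n} → Family n → Fin n → Family n
del X v S = X S ∧ not (lookup S v)

lk : ∀ {n} → Family n → Fin n → Family n
lk X v S = not (lookup S v) ∧ X (S ∪ ⁅ v ⁆)

isVertex : ∀ {n} → Family n → Fin n → Bool
isVertex X v = X ⁅ v ⁆

isCone : ∀ {n} → Family n → Fin n → Bool
isCone {n} X v = and (map (λ S → ⌊ lk X v S ≟ᵇ del X v S ⌋) (allSubsets n))

nonConeVertices : ∀ {n} → Family n → List (Fin n)
nonConeVertices {n} X = filter (λ v → isVertex X v ∧ not (isCone X v) ≟ᵇ true) (allFin n)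

minList : List ℕ → ℕ
minList []       = 0
minList (x ∷ []) = x
minList (x ∷ y ∷ xs) = x ⊓ minList (y ∷ xs)

-- Each recursive call removes the vertex v from the vertex
-- set, so fuel = n (the size of the ground set) is always sufficient; with
-- no non-cone vertex the minimum over the empty list is 0, as required.
θ-fuel : ∀ {n} → ℕ → Family n → ℕ
θ-fuel zero    X = 0
θ-fuel (suc f) X =
  minList (map (λ v → θ-fuel f (del X v) ⊔ suc (θ-fuel f (lk X v))) (nonConeVertices X))

θ : ∀ {n} → Family n → ℕ
θ {n} X = θ-fuel n X

FreePair : ∀ {n} → Family n → Subset n → Subset n → Set
FreePair X A B =
  X A ≡ true × X B ≡ true × A ⊆ B × (∀ C → X C ≡ true → A ⊆ C → C ⊆ B)

RemoveInterval : ∀ {n} → Family n → Subset n → Subset n → Family n → Set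
RemoveInterval X A B Y =
  ∀ C → (Y C ≡ true → X C ≡ true × ¬ (A ⊆ C × C ⊆ B))
      × (X C ≡ true → ¬ (A ⊆ C × C ⊆ B) → Y C ≡ true)

data Collapsible {n : ℕ} (k : ℕ) : Family n → Set where
  void     : ∀ {X} → (∀ S → X S ≡ false) → Collapsible k X
  collapse : ∀ {X} (A B : Subset n) (Y : Family n) →
             FreePair X A B → ∣ A ∣ ≤ k → RemoveInterval X A B Y →
             Collapsible k Y → Collapsible k X

-- C(X) ≤ m  iff  X is k-collapsible for some k ≤ m  (C(X) = least such k)
CollapsibilityNumber≤ : ∀ {n} → Complex n → ℕ → Set
CollapsibilityNumber≤ X m = Σ ℕ (λ k → k ≤ m × Collapsible k (face X))

-- Induction on the number of vertices, following the recursion defining θ.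
-- Every complex splits at a vertex v as X = del(X;v) ∪ v ∗ lk(X;v).  A
-- k-collapse (A, B) of the link lifts to the (k+1)-collapse (A ∪ v, B ∪ v) of
-- X, and these remove the whole cone v ∗ lk(X;v); what remains is del(X;v).
-- Collapsing the link first and then the deletion shows
-- C(X) ≤ max(C(del(X;v)), C(lk(X;v)) + 1).  When every vertex is a cone vertex
-- the complex is an iterated cone, and a collapse (A, B) of the base lifts to
-- the collapse (A, B ∪ v) of the cone, so X is 0-collapsible.
module Submission where

open import Defs
open import Data.Nat using (ℕ; zero; suc; _≤_; _⊔_; s≤s)
open import Data.Nat.Properties
  using (≤-refl; ≤-trans; ≤-reflexive; ≤-pred; <-≤-trans; n≤1+n; n≮0; m≤m⊔n; m≤n⊔m; ⊓-sel)
open import Data.Bool using (Bool; true; false; _∧_; _∨_; not; if_then_else_)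
open import Data.Bool.Properties
  using (∧-assoc; ∧-comm; ∧-identityʳ; ∧-conicalˡ; ∧-conicalʳ; ∨-identityʳ; ¬-not; T-≡)
  renaming (_≟_ to _≟ᵇ_)
open import Data.Bool.ListAction using (and)
open import Data.Fin using (Fin; zero; suc)
open import Data.Fin.Properties using () renaming (_≟_ to _≟ᶠ_)
open import Data.Fin.Subset
  using (Subset; _⊆_; _∈_; _∉_; ⁅_⁆; _∪_; _-_; ∣_∣; outside; inside; ⊥)
open import Data.Fin.Subset.Properties
  using ( _∈?_; ⊆-refl; ⊆-reflexive; ⊆-trans; ⊆-antisym; ⊥⊆; ∣⊥∣≡0; ∣⊤∣≡n; ∈⊤
        ; ∪-identityʳ; p⊆p∪q; q⊆p∪q; x∈p∪q⁻; x∈⁅x⁆; x∈⁅y⁆⇒x≡y; x≢y⇒x∉⁅y⁆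
        ; drop-there; p─q⊆p; x∈p∧x≢y⇒x∈p-y; x∈p⇒∣p-x∣<∣p∣; Empty-unique)
open import Data.Vec using ([]; _∷_; lookup)
open import Data.Vec.Properties using ([]=⇒lookup; lookup⇒[]=; lookup-zipWith)
open import Data.List using (List; []; _∷_; map; allFin)
open import Data.List.Membership.Propositional using () renaming (_∈_ to _∈ₗ_)
open import Data.List.Membership.Propositional.Properties
  using (∈-filter⁺; ∈-filter⁻; ∈-map⁺; ∈-++⁺ˡ; ∈-++⁺ʳ; ∈-allFin)
open import Data.List.Relation.Unary.Any using (here; there)
open import Data.List.Relation.Unary.Any.Properties using (¬Any[])
open import Data.Product using (Σ; _×_; _,_; proj₁; proj₂)
open import Data.Sum using (inj₁; inj₂)
open import Function using (_∘_; id; Equivalence)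
open import Relation.Nullary using (¬_; Dec; yes; no; contradiction)
open import Relation.Nullary.Decidable using (⌊_⌋; toWitness)
open import Relation.Binary.PropositionalEquality

private variable
  n : ℕ
  p q A B C W : Subset n
  u v x y : Fin n

Interval : Subset n → Subset n → Subset n → Set
Interval A B C = A ⊆ C × C ⊆ B

∉⇒lookup≡false : x ∉ p → lookup p x ≡ false
∉⇒lookup≡false {x = x} {p = p} x∉p with lookup p x in eq
... | true  = contradiction (lookup⇒[]= x p eq) x∉p
... | false = refl

∉⇒not-lookup : x ∉ p → not (lookup p x) ≡ true
∉⇒not-lookup = cong not ∘ ∉⇒lookup≡false

not-lookup⇒∉ : not (lookup p x) ≡ true → x ∉ p
not-lookup⇒∉ eq x∈p with () ← trans (sym (cong not ([]=⇒lookup x∈p))) eq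

x∉p-x : ∀ (p : Subset n) x → x ∉ p - x
x∉p-x (s ∷ p) zero    ()
x∉p-x (s ∷ p) (suc x) = x∉p-x p x ∘ drop-there

x∈p-y⇒x≢y : x ∈ p - y → x ≢ y
x∈p-y⇒x≢y {p = p} x∈p-y refl = x∉p-x p _ x∈p-y

lookup-∪⁅y⁆ : x ≢ y → lookup (p ∪ ⁅ y ⁆) x ≡ lookup p x
lookup-∪⁅y⁆ {x = x} {y = y} {p = p} x≢y = begin
  lookup (p ∪ ⁅ y ⁆) x          ≡⟨ lookup-zipWith _∨_ x p ⁅ y ⁆ ⟩
  lookup p x ∨ lookup ⁅ y ⁆ x   ≡⟨ cong (lookup p x ∨_) (∉⇒lookup≡false (x≢y⇒x∉⁅y⁆ x≢y)) ⟩
  lookup p x ∨ false            ≡⟨ ∨-identityʳ _ ⟩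
  lookup p x                    ∎
  where open ≡-Reasoning

y∈p∪⁅y⁆ : y ∈ p ∪ ⁅ y ⁆
y∈p∪⁅y⁆ {y = y} {p = p} = q⊆p∪q p ⁅ y ⁆ (x∈⁅x⁆ y)

⊆-∪⁅y⁆ : p ⊆ q → p ⊆ q ∪ ⁅ y ⁆
⊆-∪⁅y⁆ {y = y} p⊆q = p⊆p∪q ⁅ y ⁆ ∘ p⊆q

⊆-y : y ∉ p → p ⊆ q → p ⊆ q - y
⊆-y y∉p p⊆q x∈p = x∈p∧x≢y⇒x∈p-y (p⊆q x∈p) λ { refl → y∉p x∈p }

p-y⊆q⇒p⊆q∪⁅y⁆ : p - y ⊆ q → p ⊆ q ∪ ⁅ y ⁆
p-y⊆q⇒p⊆q∪⁅y⁆ {y = y} p-y⊆q {x} x∈p with x ≟ᶠ y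
... | yes refl = y∈p∪⁅y⁆
... | no  x≢y  = p⊆p∪q ⁅ y ⁆ (p-y⊆q (x∈p∧x≢y⇒x∈p-y x∈p x≢y))

p⊆q∪⁅y⁆⇒p-y⊆q : p ⊆ q ∪ ⁅ y ⁆ → p - y ⊆ q
p⊆q∪⁅y⁆⇒p-y⊆q {p = p} {q = q} {y = y} p⊆q∪⁅y⁆ x∈p-y
  with x∈p∪q⁻ q ⁅ y ⁆ (p⊆q∪⁅y⁆ (p─q⊆p p ⁅ y ⁆ x∈p-y))
... | inj₁ x∈q   = x∈q
... | inj₂ x∈⁅y⁆ = contradiction (x∈⁅y⁆⇒x≡y y x∈⁅y⁆) (x∈p-y⇒x≢y x∈p-y)

∪⁅y⁆⊆⁺ : p ⊆ q → y ∈ q → p ∪ ⁅ y ⁆ ⊆ q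
∪⁅y⁆⊆⁺ {p = p} {y = y} p⊆q y∈q x∈ with x∈p∪q⁻ p ⁅ y ⁆ x∈
... | inj₁ x∈p   = p⊆q x∈p
... | inj₂ x∈⁅y⁆ rewrite x∈⁅y⁆⇒x≡y y x∈⁅y⁆ = y∈q

∪⁅y⁆⊆⁻ : p ∪ ⁅ y ⁆ ⊆ q → p ⊆ q × y ∈ q
∪⁅y⁆⊆⁻ {y = y} p∪⁅y⁆⊆q = p∪⁅y⁆⊆q ∘ p⊆p∪q ⁅ y ⁆ , p∪⁅y⁆⊆q y∈p∪⁅y⁆

∪⁅y⁆-mono : p ⊆ q → p ∪ ⁅ y ⁆ ⊆ q ∪ ⁅ y ⁆
∪⁅y⁆-mono p⊆q = ∪⁅y⁆⊆⁺ (⊆-∪⁅y⁆ p⊆q) y∈p∪⁅y⁆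

p-y≡p : y ∉ p → p - y ≡ p
p-y≡p {y = y} {p = p} y∉p = ⊆-antisym (p─q⊆p p ⁅ y ⁆) (⊆-y y∉p ⊆-refl)

[p∪⁅y⁆]-y≡p : y ∉ p → (p ∪ ⁅ y ⁆) - y ≡ p
[p∪⁅y⁆]-y≡p {y = y} y∉p = ⊆-antisym (p⊆q∪⁅y⁆⇒p-y⊆q ⊆-refl) (⊆-y y∉p (p⊆p∪q ⁅ y ⁆))

[p-y]∪⁅y⁆≡p : y ∈ p → (p - y) ∪ ⁅ y ⁆ ≡ p
[p-y]∪⁅y⁆≡p {y = y} {p = p} y∈p =
  ⊆-antisym (∪⁅y⁆⊆⁺ (p─q⊆p p ⁅ y ⁆) y∈p) (p-y⊆q⇒p⊆q∪⁅y⁆ ⊆-refl)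

∣p∪⁅x⁆∣≤1+∣p∣ : ∀ (p : Subset n) x → ∣ p ∪ ⁅ x ⁆ ∣ ≤ suc ∣ p ∣
∣p∪⁅x⁆∣≤1+∣p∣ (inside  ∷ p) zero    rewrite ∪-identityʳ p = n≤1+n _
∣p∪⁅x⁆∣≤1+∣p∣ (outside ∷ p) zero    rewrite ∪-identityʳ p = ≤-refl
∣p∪⁅x⁆∣≤1+∣p∣ (inside  ∷ p) (suc x) = s≤s (∣p∪⁅x⁆∣≤1+∣p∣ p x)
∣p∪⁅x⁆∣≤1+∣p∣ (outside ∷ p) (suc x) = ∣p∪⁅x⁆∣≤1+∣p∣ p x

Interval-∪⁅v⁆⁻ : v ∉ A → Interval (A ∪ ⁅ v ⁆) (B ∪ ⁅ v ⁆) C → Interval A B (C - v)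
Interval-∪⁅v⁆⁻ v∉A (A∪⁅v⁆⊆C , C⊆B∪⁅v⁆) =
  ⊆-y v∉A (proj₁ (∪⁅y⁆⊆⁻ A∪⁅v⁆⊆C)) , p⊆q∪⁅y⁆⇒p-y⊆q C⊆B∪⁅v⁆

Interval-∪⁅v⁆⁺ : v ∈ C → Interval A B (C - v) → Interval (A ∪ ⁅ v ⁆) (B ∪ ⁅ v ⁆) C
Interval-∪⁅v⁆⁺ {v = v} {C = C} v∈C (A⊆C-v , C-v⊆B) =
  ∪⁅y⁆⊆⁺ (⊆-trans A⊆C-v (p─q⊆p C ⁅ v ⁆)) v∈C , p-y⊆q⇒p⊆q∪⁅y⁆ C-v⊆B

Interval-ʳ∪⁅v⁆⁻ : v ∉ A → Interval A (B ∪ ⁅ v ⁆) C → Interval A B (C - v)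
Interval-ʳ∪⁅v⁆⁻ v∉A (A⊆C , C⊆B∪⁅v⁆) = ⊆-y v∉A A⊆C , p⊆q∪⁅y⁆⇒p-y⊆q C⊆B∪⁅v⁆

Interval-ʳ∪⁅v⁆⁺ : Interval A B (C - v) → Interval A (B ∪ ⁅ v ⁆) C
Interval-ʳ∪⁅v⁆⁺ {C = C} {v = v} (A⊆C-v , C-v⊆B) =
  ⊆-trans A⊆C-v (p─q⊆p C ⁅ v ⁆) , p-y⊆q⇒p⊆q∪⁅y⁆ C-v⊆B

RemovedAt : Family n → Subset n → Subset n → Family n → Subset n → Set
RemovedAt X A B Y C = (Y C ≡ true → X C ≡ true × ¬ Interval A B C)
                    × (X C ≡ true → ¬ Interval A B C → Y C ≡ true)

RemovedAt-transfer : ∀ {X Y X′ Y′ : Family n} {A′ B′ C′} →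
                     X′ C′ ≡ X C → Y′ C′ ≡ Y C →
                     (Interval A′ B′ C′ → Interval A B C) → (Interval A B C → Interval A′ B′ C′) →
                     RemovedAt X A B Y C → RemovedAt X′ A′ B′ Y′ C′
RemovedAt-transfer eqX eqY to from (removed , kept) =
    (λ y → let x , out = removed (trans (sym eqY) y) in trans eqX x , out ∘ to)
  , (λ x out → trans eqY (kept (trans (sym eqX) x) (out ∘ from)))

RemovedAt-outside : ∀ {X Y : Family n} → Y C ≡ X C → ¬ Interval A B C → RemovedAt X A B Y C
RemovedAt-outside eq out = (λ y → trans (sym eq) y , out) , (λ x _ → trans eq x)

Collapsible-resp : ∀ {k} {X X′ : Family n} → (∀ S → X S ≡ X′ S) → Collapsible k X → Collapsible k X′
Collapsible-resp eq (void empty) = void (λ S → trans (sym (eq S)) (empty S))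
Collapsible-resp {X = X} {X′} eq (collapse A B Y (xA , xB , A⊆B , facet) size removal rest) =
  collapse A B Y (trans (sym (eq A)) xA , trans (sym (eq B)) xB , A⊆B , λ C → facet C ∘ trans (eq C))
    size (λ C → RemovedAt-transfer {X = X} {Y = Y} {X′ = X′} {Y′ = Y} (sym (eq C)) refl id id (removal C))
    rest

Collapsible-mono : ∀ {j k} {X : Family n} → j ≤ k → Collapsible j X → Collapsible k X
Collapsible-mono j≤k (void empty) = void empty
Collapsible-mono j≤k (collapse A B Y free size removal rest) =
  collapse A B Y free (≤-trans size j≤k) removal (Collapsible-mono j≤k rest)

Avoids : Fin n → Family n → Set
Avoids v X = ∀ S → X S ≡ true → v ∉ S

Avoids-removal : ∀ {X Y : Family n} → RemoveInterval X A B Y → Avoids v X → Avoids v Y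
Avoids-removal removal avoids S y = avoids S (proj₁ (proj₁ (removal S) y))

-- For D avoiding v this is the cone v ∗ D.
cone : Fin n → Family n → Family n
cone v D C = D (C - v)

cone-free : ∀ {D : Family n} → Avoids v D → FreePair D A B → FreePair (cone v D) A (B ∪ ⁅ v ⁆)
cone-free {v = v} {A = A} {B = B} {D = D} avoids (dA , dB , A⊆B , facet) =
    subst (λ S → D S ≡ true) (sym (p-y≡p (avoids A dA))) dA
  , subst (λ S → D S ≡ true) (sym ([p∪⁅y⁆]-y≡p (avoids B dB))) dB
  , ⊆-∪⁅y⁆ A⊆B
  , λ C dC A⊆C → p-y⊆q⇒p⊆q∪⁅y⁆ (facet (C - v) dC (⊆-y (avoids A dA) A⊆C))

cone-removal : ∀ {D D′ : Family n} → v ∉ A → RemoveInterval D A B D′ →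
               RemoveInterval (cone v D) A (B ∪ ⁅ v ⁆) (cone v D′)
cone-removal {v = v} {D = D} {D′} v∉A removal C =
  RemovedAt-transfer {X = D} {Y = D′} {X′ = cone v D} {Y′ = cone v D′}
    refl refl (Interval-ʳ∪⁅v⁆⁻ v∉A) Interval-ʳ∪⁅v⁆⁺ (removal (C - v))

cone-collapsible : ∀ {k} {D : Family n} → Avoids v D → Collapsible k D → Collapsible k (cone v D)
cone-collapsible avoids (void empty) = void (λ S → empty (_ - _))
cone-collapsible avoids (collapse A B D′ free@(dA , _) size removal rest) =
  collapse A _ _ (cone-free avoids free) size (cone-removal (avoids A dA) removal)
    (cone-collapsible (Avoids-removal removal avoids) rest)

-- For D and L avoiding v this is D ∪ v ∗ L.
join : Fin n → Family n → Family n → Family n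
join v D L C = if ⌊ v ∈? C ⌋ then L (C - v) else D C

module _ {v : Fin n} {C : Subset n} (D L : Family n) where

  join-∈ : v ∈ C → join v D L C ≡ L (C - v)
  join-∈ v∈C with v ∈? C
  ... | yes _   = refl
  ... | no  v∉C = contradiction v∈C v∉C

  join-∉ : v ∉ C → join v D L C ≡ D C
  join-∉ v∉C with v ∈? C
  ... | yes v∈C = contradiction v∈C v∉C
  ... | no  _   = refl

join-free : ∀ {D L : Family n} → Avoids v L → FreePair L A B →
            FreePair (join v D L) (A ∪ ⁅ v ⁆) (B ∪ ⁅ v ⁆)
join-free {v = v} {A = A} {B = B} {D = D} {L} avoids (lA , lB , A⊆B , facet) =
    face-∪⁅v⁆ lA
  , face-∪⁅v⁆ lB
  , ∪⁅y⁆-mono A⊆B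
  , λ C jC A∪⁅v⁆⊆C →
      let A⊆C , v∈C = ∪⁅y⁆⊆⁻ A∪⁅v⁆⊆C in
      p-y⊆q⇒p⊆q∪⁅y⁆ (facet (C - v) (trans (sym (join-∈ D L v∈C)) jC) (⊆-y (avoids A lA) A⊆C))
  where
  face-∪⁅v⁆ : ∀ {S} → L S ≡ true → join v D L (S ∪ ⁅ v ⁆) ≡ true
  face-∪⁅v⁆ {S} lS = begin
    join v D L (S ∪ ⁅ v ⁆) ≡⟨ join-∈ D L y∈p∪⁅y⁆ ⟩
    L ((S ∪ ⁅ v ⁆) - v)    ≡⟨ cong L ([p∪⁅y⁆]-y≡p (avoids S lS)) ⟩
    L S                    ≡⟨ lS ⟩
    true                   ∎
    where open ≡-Reasoning

join-removal : ∀ {D L L′ : Family n} → v ∉ A → RemoveInterval L A B L′ →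
               RemoveInterval (join v D L) (A ∪ ⁅ v ⁆) (B ∪ ⁅ v ⁆) (join v D L′)
join-removal {v = v} {A = A} {B = B} {D = D} {L} {L′} v∉A removal C = at (v ∈? C)
  where
  at : Dec (v ∈ C) → RemovedAt (join v D L) (A ∪ ⁅ v ⁆) (B ∪ ⁅ v ⁆) (join v D L′) C
  at (yes v∈C) = RemovedAt-transfer {X = L} {Y = L′} {X′ = join v D L} {Y′ = join v D L′}
                   (join-∈ D L v∈C) (join-∈ D L′ v∈C)
                   (Interval-∪⁅v⁆⁻ v∉A) (Interval-∪⁅v⁆⁺ v∈C) (removal (C - v))
  at (no v∉C)  = RemovedAt-outside {X = join v D L} {Y = join v D L′}
                   (trans (join-∉ D L′ v∉C) (sym (join-∉ D L v∉C)))
                   (v∉C ∘ proj₂ ∘ ∪⁅y⁆⊆⁻ ∘ proj₁)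

join-void : ∀ {D L : Family n} → Avoids v D → (∀ S → L S ≡ false) → ∀ S → D S ≡ join v D L S
join-void {v = v} {D = D} {L} avoids empty S = at (v ∈? S)
  where
  at : Dec (v ∈ S) → D S ≡ join v D L S
  at (no v∉S)  = sym (join-∉ D L v∉S)
  at (yes v∈S) = trans (¬-not λ dS → avoids S dS v∈S) (sym (trans (join-∈ D L v∈S) (empty (S - v))))

join-collapsible : ∀ {j k} {D L : Family n} → Avoids v D → Avoids v L → suc j ≤ k →
                   Collapsible k D → Collapsible j L → Collapsible k (join v D L)
join-collapsible avoidsD avoidsL j<k collD (void empty) = Collapsible-resp (join-void avoidsD empty) collD
join-collapsible {v = v} avoidsD avoidsL j<k collD (collapse A B L′ free@(lA , _) size removal rest) =
  collapse (A ∪ ⁅ v ⁆) (B ∪ ⁅ v ⁆) _ (join-free avoidsL free)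
    (≤-trans (∣p∪⁅x⁆∣≤1+∣p∣ A v) (≤-trans (s≤s size) j<k))
    (join-removal (avoidsL A lA) removal)
    (join-collapsible avoidsD (Avoids-removal removal avoidsL) j<k collD rest)

DownClosed : Family n → Set
DownClosed X = ∀ S T → T ⊆ S → X S ≡ true → X T ≡ true

Covers : Subset n → Family n → Set
Covers W X = ∀ u → X ⁅ u ⁆ ≡ true → u ∈ W

module _ (X : Family n) (v : Fin n) where

  del-downClosed : DownClosed X → DownClosed (del X v)
  del-downClosed down S T T⊆S dS = cong₂ _∧_ (down S T T⊆S (∧-conicalˡ _ _ dS)) (∉⇒not-lookup (v∉S ∘ T⊆S))
    where v∉S = not-lookup⇒∉ (∧-conicalʳ _ _ dS)

  lk-downClosed : DownClosed X → DownClosed (lk X v)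
  lk-downClosed down S T T⊆S lS =
    cong₂ _∧_ (∉⇒not-lookup (v∉S ∘ T⊆S)) (down _ _ (∪⁅y⁆-mono T⊆S) (∧-conicalʳ _ _ lS))
    where v∉S = not-lookup⇒∉ (∧-conicalˡ _ _ lS)

  del-avoids : Avoids v (del X v)
  del-avoids S = not-lookup⇒∉ ∘ ∧-conicalʳ _ _

  lk-avoids : Avoids v (lk X v)
  lk-avoids S = not-lookup⇒∉ ∘ ∧-conicalˡ _ _

  del-vertex : del X v ⁅ u ⁆ ≡ true → X ⁅ u ⁆ ≡ true × u ≢ v
  del-vertex dU = ∧-conicalˡ _ _ dU , λ { refl → not-lookup⇒∉ (∧-conicalʳ _ _ dU) (x∈⁅x⁆ v) }

  lk-vertex : DownClosed X → lk X v ⁅ u ⁆ ≡ true → X ⁅ u ⁆ ≡ true × u ≢ v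
  lk-vertex down lU =
      down _ _ (p⊆p∪q ⁅ v ⁆) (∧-conicalʳ _ _ lU)
    , λ { refl → not-lookup⇒∉ (∧-conicalˡ _ _ lU) (x∈⁅x⁆ v) }

  del-covers : Covers W X → Covers (W - v) (del X v)
  del-covers covers u dU = let xU , u≢v = del-vertex dU in x∈p∧x≢y⇒x∈p-y (covers u xU) u≢v

  lk-covers : DownClosed X → Covers W X → Covers (W - v) (lk X v)
  lk-covers down covers u lU = let xU , u≢v = lk-vertex down lU in x∈p∧x≢y⇒x∈p-y (covers u xU) u≢v

  join-del-lk : ∀ S → join v (del X v) (lk X v) S ≡ X S
  join-del-lk S = at (v ∈? S)
    where
    open ≡-Reasoning
    at : Dec (v ∈ S) → join v (del X v) (lk X v) S ≡ X S
    at (yes v∈S) = begin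
      join v (del X v) (lk X v) S ≡⟨ join-∈ (del X v) (lk X v) v∈S ⟩
      lk X v (S - v)              ≡⟨ cong₂ _∧_ (∉⇒not-lookup (x∉p-x S v)) (cong X ([p-y]∪⁅y⁆≡p v∈S)) ⟩
      X S                         ∎
    at (no v∉S) = begin
      join v (del X v) (lk X v) S ≡⟨ join-∉ (del X v) (lk X v) v∉S ⟩
      X S ∧ not (lookup S v)      ≡⟨ cong (X S ∧_) (∉⇒not-lookup v∉S) ⟩
      X S ∧ true                  ≡⟨ ∧-identityʳ _ ⟩
      X S                         ∎

  collapsible-del-lk : ∀ {a b} → Collapsible a (del X v) → Collapsible b (lk X v) →
                       Collapsible (a ⊔ suc b) X
  collapsible-del-lk {a} {b} collDel collLk =
    Collapsible-resp join-del-lk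
      (join-collapsible del-avoids lk-avoids (m≤n⊔m a (suc b))
        (Collapsible-mono (m≤m⊔n a (suc b)) collDel) collLk)

ConeAt : Family n → Fin n → Set
ConeAt X v = ∀ S → lk X v S ≡ del X v S

AllCone : Family n → Set
AllCone X = ∀ u → X ⁅ u ⁆ ≡ true → ConeAt X u

cone-del : ∀ {X : Family n} → ConeAt X v → ∀ S → cone v (del X v) S ≡ X S
cone-del {v = v} {X = X} coneAt S = at (v ∈? S)
  where
  open ≡-Reasoning
  at : Dec (v ∈ S) → cone v (del X v) S ≡ X S
  at (yes v∈S) = begin
    del X v (S - v)             ≡⟨ sym (coneAt (S - v)) ⟩
    lk X v (S - v)              ≡⟨ sym (join-∈ (del X v) (lk X v) v∈S) ⟩
    join v (del X v) (lk X v) S ≡⟨ join-del-lk X v S ⟩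
    X S                         ∎
  at (no v∉S) = begin
    del X v (S - v)             ≡⟨ cong (del X v) (p-y≡p v∉S) ⟩
    del X v S                   ≡⟨ sym (join-∉ (del X v) (lk X v) v∉S) ⟩
    join v (del X v) (lk X v) S ≡⟨ join-del-lk X v S ⟩
    X S                         ∎

coneVertex-collapsible : ∀ {k} {X : Family n} → ConeAt X v → Collapsible k (del X v) → Collapsible k X
coneVertex-collapsible {v = v} {X = X} coneAt =
  Collapsible-resp (cone-del coneAt) ∘ cone-collapsible (del-avoids X v)

del-allCone : ∀ {X : Family n} v → AllCone X → AllCone (del X v)
del-allCone {X = X} v allCone u dU S = begin
  not a ∧ (X S∪u ∧ not (lookup S∪u v)) ≡⟨ cong (λ c → not a ∧ (X S∪u ∧ not c)) (lookup-∪⁅y⁆ {p = S} v≢u) ⟩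
  not a ∧ (X S∪u ∧ not b)              ≡⟨ sym (∧-assoc (not a) _ _) ⟩
  (not a ∧ X S∪u) ∧ not b              ≡⟨ cong (_∧ not b) (allCone u xU S) ⟩
  (X S ∧ not a) ∧ not b                ≡⟨ ∧-assoc (X S) _ _ ⟩
  X S ∧ (not a ∧ not b)                ≡⟨ cong (X S ∧_) (∧-comm (not a) _) ⟩
  X S ∧ (not b ∧ not a)                ≡⟨ sym (∧-assoc (X S) _ _) ⟩
  (X S ∧ not b) ∧ not a                ∎
  where
  open ≡-Reasoning
  S∪u = S ∪ ⁅ u ⁆
  a = lookup S u
  b = lookup S v
  xU = proj₁ (del-vertex X v dU)
  v≢u = λ v≡u → proj₂ (del-vertex X v dU) (sym v≡u)

⁅x⁆⊆ : x ∈ p → ⁅ x ⁆ ⊆ p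
⁅x⁆⊆ {x = x} {p = p} x∈p y∈⁅x⁆ = subst (_∈ p) (sym (x∈⁅y⁆⇒x≡y x y∈⁅x⁆)) x∈p

∈-tail : ∀ {vs : List (Fin n)} → u ≢ v → u ∈ₗ v ∷ vs → u ∈ₗ vs
∈-tail u≢v (here u≡v)   = contradiction u≡v u≢v
∈-tail u≢v (there u∈vs) = u∈vs

noVertices⇒≡⊥ : ∀ {X : Family n} → DownClosed X → (∀ u → X ⁅ u ⁆ ≢ true) → X C ≡ true → C ≡ ⊥
noVertices⇒≡⊥ down noVertex xC = Empty-unique λ (u , u∈C) → noVertex u (down _ _ (⁅x⁆⊆ u∈C) xC)

noVertices-collapsible : ∀ {X : Family n} → DownClosed X → (∀ u → X ⁅ u ⁆ ≢ true) → Collapsible 0 X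
noVertices-collapsible {n = n} {X = X} down noVertex with X ⊥ in x⊥
... | true  = collapse ⊥ ⊥ (λ _ → false)
                (x⊥ , x⊥ , ⊆-refl , λ C xC _ → proj₂ (in-⊥⊥ xC))
                (≤-reflexive (∣⊥∣≡0 n))
                (λ C → (λ ()) , λ xC out → contradiction (in-⊥⊥ xC) out)
                (void λ _ → refl)
  where
  in-⊥⊥ : ∀ {C} → X C ≡ true → Interval ⊥ ⊥ C
  in-⊥⊥ xC = ⊥⊆ , ⊆-reflexive (noVertices⇒≡⊥ down noVertex xC)
... | false = void λ S → ¬-not λ xS →
                contradiction (trans (sym (subst (λ T → X T ≡ true) (noVertices⇒≡⊥ down noVertex xS) xS)) x⊥)
                  λ ()

allCone-collapsible : ∀ (vs : List (Fin n)) {X : Family n} → DownClosed X → AllCone X →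
                      (∀ u → X ⁅ u ⁆ ≡ true → u ∈ₗ vs) → Collapsible 0 X
allCone-collapsible []       down allCone covered = noVertices-collapsible down λ u → (λ ()) ∘ covered u
allCone-collapsible (v ∷ vs) {X} down allCone covered with X ⁅ v ⁆ in xV
... | false = allCone-collapsible vs down allCone λ u xU →
                ∈-tail (λ { refl → contradiction (trans (sym xU) xV) λ () }) (covered u xU)
... | true  = coneVertex-collapsible (allCone v xV)
                (allCone-collapsible vs (del-downClosed X v down) (del-allCone v allCone) λ u dU →
                  let xU , u≢v = del-vertex X v dU in ∈-tail u≢v (covered u xU))

and-map⁻ : ∀ {A : Set} (f : A → Bool) {xs x} → and (map f xs) ≡ true → x ∈ₗ xs → f x ≡ true
and-map⁻ f {x ∷ xs} all (here refl) = ∧-conicalˡ _ _ all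
and-map⁻ f {x ∷ xs} all (there x∈) = and-map⁻ f (∧-conicalʳ _ _ all) x∈

∈-allSubsets : ∀ (S : Subset n) → S ∈ₗ allSubsets n
∈-allSubsets []            = here refl
∈-allSubsets (outside ∷ S) = ∈-++⁺ˡ (∈-map⁺ (outside ∷_) (∈-allSubsets S))
∈-allSubsets (inside ∷ S)  = ∈-++⁺ʳ _ (∈-map⁺ (inside ∷_) (∈-allSubsets S))

isCone-sound : ∀ (X : Family n) u → isCone X u ≡ true → ConeAt X u
isCone-sound X u cone S =
  toWitness (Equivalence.from T-≡ (and-map⁻ (λ S → ⌊ lk X u S ≟ᵇ del X u S ⌋) cone (∈-allSubsets S)))

nonConeVertex? : ∀ (X : Family n) v → Dec (isVertex X v ∧ not (isCone X v) ≡ true)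
nonConeVertex? X v = isVertex X v ∧ not (isCone X v) ≟ᵇ true

nonConeVertices-vertex : ∀ (X : Family n) → v ∈ₗ nonConeVertices X → X ⁅ v ⁆ ≡ true
nonConeVertices-vertex {n} X v∈ = ∧-conicalˡ _ _ (proj₂ (∈-filter⁻ (nonConeVertex? X) {xs = allFin n} v∈))

nonConeVertices≡[]⇒AllCone : ∀ (X : Family n) → nonConeVertices X ≡ [] → AllCone X
nonConeVertices≡[]⇒AllCone X none u xU with isCone X u in cone
... | true  = isCone-sound X u cone
... | false = contradiction (subst (u ∈ₗ_) none u∈) ¬Any[]
  where u∈ = ∈-filter⁺ (nonConeVertex? X) (∈-allFin u) (cong₂ (λ a b → a ∧ not b) xU cone)

minList-attained : ∀ {A : Set} (f : A → ℕ) w ws →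
                   Σ A λ v → v ∈ₗ w ∷ ws × minList (map f (w ∷ ws)) ≡ f v
minList-attained f w []       = w , here refl , refl
minList-attained f w (y ∷ ys) with minList-attained f y ys | ⊓-sel (f w) (minList (map f (y ∷ ys)))
... | _ , _   , _     | inj₁ min≡fw = w , here refl , min≡fw
... | v , v∈ , min≡fv | inj₂ min≡   = v , there v∈ , trans min≡ min≡fv

-- The vertices lie in W and ∣ W ∣ ≤ f, so the fuel outlasts the recursion of θ.
collapsible-θ-fuel : ∀ f {X : Family n} {W} → ∣ W ∣ ≤ f → DownClosed X → Covers W X →
                     Collapsible (θ-fuel f X) X
collapsible-θ-fuel zero    ∣W∣≤0 down covers =
  noVertices-collapsible down λ u xU → n≮0 (<-≤-trans (x∈p⇒∣p-x∣<∣p∣ (covers u xU)) ∣W∣≤0)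
collapsible-θ-fuel {n} (suc f) {X} ∣W∣≤1+f down covers = by-cases (nonConeVertices X) refl
  where
  cost : Fin n → ℕ
  cost v = θ-fuel f (del X v) ⊔ suc (θ-fuel f (lk X v))

  split-at : ∀ v → X ⁅ v ⁆ ≡ true → Collapsible (cost v) X
  split-at v xV = collapsible-del-lk X v
    (collapsible-θ-fuel f ∣W-v∣≤f (del-downClosed X v down) (del-covers X v covers))
    (collapsible-θ-fuel f ∣W-v∣≤f (lk-downClosed X v down) (lk-covers X v down covers))
    where ∣W-v∣≤f = ≤-pred (≤-trans (x∈p⇒∣p-x∣<∣p∣ (covers v xV)) ∣W∣≤1+f)

  by-cases : ∀ vs → nonConeVertices X ≡ vs → Collapsible (minList (map cost vs)) X
  by-cases []       none =
    allCone-collapsible (allFin n) down (nonConeVertices≡[]⇒AllCone X none) (λ u _ → ∈-allFin u)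
  by-cases (w ∷ ws) eq with minList-attained cost w ws
  ... | v , v∈ , min≡ = subst (λ k → Collapsible k X) (sym min≡)
                          (split-at v (nonConeVertices-vertex X (subst (v ∈ₗ_) (sym eq) v∈)))

theorem25 : ∀ (n : ℕ) (X : Complex n) → CollapsibilityNumber≤ X (θ (face X))
theorem25 n X =
  θ (face X) , ≤-refl , collapsible-θ-fuel n (≤-reflexive (∣⊤∣≡n n)) (downward X) (λ u _ → ∈⊤)
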